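{- For every $\phi\in\mathcal{L}_{qu}$ there is a nonempty set $\mathcal{C}$ of teams over $\mathbb{P}$, which either equals $\{\emptyset\}$ or does not contain the empty team, such that $\phi\vdash\Psi'_{\mathcal{C}}$ and $\Psi'_{\mathcal{C}}\vdash\phi$ in the natural deduction system for $\mathcal{L}_{qu}$.
   Context: Fix a finite set $\mathbb{P}$ of propositional symbols, enumerated without repetition as $\mathsf{p}=p_1\dots p_n$; a valuation is $v:\mathbb{P}\to\{0,1\}$, a team is a set of valuations. $\mathcal{L}_{qu}$: $\phi::=\bot\mid\mathsf{x}\subseteq\mathsf{q}\mid\phi\land\phi\mid\phi\sqcup\phi$, with $\mathsf{x}$ a finite sequence of constants $\top,\bot$, $\mathsf{q}$ a sequence of symbols of $\mathbb{P}$ without repetitions, $|\mathsf{x}|=|\mathsf{q}|$ (possibly empty, $\langle\rangle$). For a valuation $v$, $\mathsf{x}^v=c_1\dots c_n$ with $c_i=\top$ if $v(p_i)=1$, else $\bot$. For a team $T$, $\psi'_T:=\bigwedge_{v\in T}\mathsf{x}^v\subseteq\mathsf{p}$ (empty conjunction $=\langle\rangle\subseteq\langle\rangle$). For a nonempty $\mathcal{C}$ not containing $\emptyset$, $\Psi'_{\mathcal{C}}:=\bigsqcup_{T\in\mathcal{C}}\psi'_T$ (in some fixed order and bracketing), and $\Psi'_{\{\emptyset\}}:=\bot$. The derivability relation $\vdash$ uses the rules: ($\bot$E) from $\bot$ infer any $\phi$; ($\top$I) infer $\langle\rangle\subseteq\langle\rangle$; ($\land$I) from $\phi,\psi$ infer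 $\phi\land\psi$; ($\land$E) from $\phi\land\psi$ infer $\phi$, and $\psi$; ($\sqcup$I) from $\phi$ infer $\phi\sqcup\psi$ and $\psi\sqcup\phi$; ($\sqcup$E) from $\phi\sqcup\psi$ and derivations of $\chi$ from $\phi$ and from $\psi$, infer $\chi$ discharging them; ($\subseteq$Proj) from $\mathsf{x}y\subseteq\mathsf{p}q$ infer $\mathsf{x}\subseteq\mathsf{p}$; ($\subseteq$Perm) from $\mathsf{x}\mathsf{y}\mathsf{z}\subseteq\mathsf{u}\mathsf{v}\mathsf{w}$ infer $\mathsf{x}\mathsf{z}\mathsf{y}\subseteq\mathsf{u}\mathsf{w}\mathsf{v}$ provided $|\mathsf{y}|=|\mathsf{v}|$, $|\mathsf{z}|=|\mathsf{w}|$; ($\subseteq$Ext) from $\mathsf{x}\subseteq\mathsf{p}$ and derivations of $\chi$ from $\mathsf{x}\top\subseteq\mathsf{p}q$ and from $\mathsf{x}\bot\subseteq\mathsf{p}q$ ($q$ a symbol not in $\mathsf{p}$), infer $\chi$ discharging them. -}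

module Defs where

open import Data.Nat using (ℕ)
open import Data.Bool using (Bool; true; false)
open import Data.Unit using (⊤)
open import Data.Fin using (Fin)
open import Data.Vec using (Vec; toList)
open import Data.List using (List; []; _∷_; _++_; map; zip; allFin; [_])
open import Data.Product using (_×_; _,_; proj₂)
open import Data.List.Membership.Propositional using (_∈_; _∉_)
open import Data.List.Relation.Unary.All using (All)
open import Data.List.Relation.Unary.AllPairs using (AllPairs)
open import Data.List.Relation.Unary.Unique.Propositional using (Unique)
open import Function.Bundles using (_⇔_)
open import Relation.Nullary using (¬_)

-- Syntax of L_qu over the symbols P = {p_1,...,p_n}, represented by Fin n
-- (enumeration p = p_1 ... p_n is the standard order of Fin n).
--
-- An inclusion atom  x ⊆ q  with |x| = |q| is represented by the list of
-- pairs (x_i , q_i); a constant ⊤ is `true`, ⊥ is `false`.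
-- The empty atom ⟨⟩ ⊆ ⟨⟩ is `incl []`.

Atom : ℕ → Set
Atom n = List (Bool × Fin n)

syms : ∀ {n} → Atom n → List (Fin n)
syms a = map proj₂ a

data Formula (n : ℕ) : Set where
  ⊥'   : Formula n
  incl : Atom n → Formula n
  _∧_  : Formula n → Formula n → Formula n
  _⊔_  : Formula n → Formula n → Formula n

infixr 6 _∧_
infixr 5 _⊔_

WF : ∀ {n} → Formula n → Set
WF ⊥'       = ⊤
WF (incl a) = Unique (syms a)
WF (φ ∧ ψ)  = WF φ × WF ψ
WF (φ ⊔ ψ)  = WF φ × WF ψ

infix 3 _⊢_

data _⊢_ {n : ℕ} (Γ : List (Formula n)) : Formula n → Set where
  assum : ∀ {φ} → φ ∈ Γ → Γ ⊢ φ
  ⊥E    : ∀ {φ} → WF φ → Γ ⊢ ⊥' → Γ ⊢ φ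
  ⊤I    : Γ ⊢ incl []
  ∧I    : ∀ {φ ψ} → Γ ⊢ φ → Γ ⊢ ψ → Γ ⊢ φ ∧ ψ
  ∧E₁   : ∀ {φ ψ} → Γ ⊢ φ ∧ ψ → Γ ⊢ φ
  ∧E₂   : ∀ {φ ψ} → Γ ⊢ φ ∧ ψ → Γ ⊢ ψ
  ⊔I₁   : ∀ {φ ψ} → WF ψ → Γ ⊢ φ → Γ ⊢ φ ⊔ ψ
  ⊔I₂   : ∀ {φ ψ} → WF φ → Γ ⊢ ψ → Γ ⊢ φ ⊔ ψ
  ⊔E    : ∀ {φ ψ χ} → Γ ⊢ φ ⊔ ψ → (φ ∷ Γ) ⊢ χ → (ψ ∷ Γ) ⊢ χ → Γ ⊢ χ
  ⊆Proj : ∀ xs a → Γ ⊢ incl (xs ++ [ a ]) → Γ ⊢ incl xs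
  ⊆Perm : ∀ xs ys zs → Γ ⊢ incl (xs ++ ys ++ zs) → Γ ⊢ incl (xs ++ zs ++ ys)
  ⊆Ext  : ∀ {χ} xs q → q ∉ syms xs → Γ ⊢ incl xs
        → (incl (xs ++ [ (true , q) ]) ∷ Γ) ⊢ χ
        → (incl (xs ++ [ (false , q) ]) ∷ Γ) ⊢ χ
        → Γ ⊢ χ

_⊢₁_ : ∀ {n} → Formula n → Formula n → Set
φ ⊢₁ ψ = (φ ∷ []) ⊢ ψ

-- v(p_i) = lookup v i  (true = 1)
Valuation : ℕ → Set
Valuation n = Vec Bool n

Team : ℕ → Set
Team n = List (Valuation n)

xv⊆p : ∀ {n} → Valuation n → Formula n
xv⊆p {n} v = incl (zip (toList v) (allFin n))

ψ' : ∀ {n} → Team n → Formula n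
ψ' []          = incl []
ψ' (v ∷ [])    = xv⊆p v
ψ' (v ∷ w ∷ T) = xv⊆p v ∧ ψ' (w ∷ T)

⨆ψ' : ∀ {n} → Team n → List (Team n) → Formula n
⨆ψ' T []       = ψ' T
⨆ψ' T (S ∷ C)  = ψ' T ⊔ ⨆ψ' S C

-- Ψ'_C ; Ψ'_{∅} = ⊥ is junk (C is always nonempty), Ψ'_{{∅}} = ⊥
Ψ' : ∀ {n} → List (Team n) → Formula n
Ψ' []              = ⊥'
Ψ' ([] ∷ [])       = ⊥'
Ψ' (T ∷ C)         = ⨆ψ' T C

_≋_ : ∀ {n} → Team n → Team n → Set
S ≋ T = ∀ v → (v ∈ S) ⇔ (v ∈ T)

-- a list of teams faithfully represents a *set* of teams:
-- no team lists a valuation twice, and no team occurs twice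
IsSetOfTeams : ∀ {n} → List (Team n) → Set
IsSetOfTeams C = All Unique C × AllPairs (λ S T → ¬ (S ≋ T)) C

-- Every formula is provably equivalent to a disjunction ⋁ψ' C of team formulas, by induction
-- on the formula: an atom x ⊆ q is split by ⊆Ext on each symbol it does not mention, giving the
-- disjunction of the x^v ⊆ p over the valuations v that extend x; a conjunction of two such
-- disjunctions is the disjunction over pairwise unions of teams; a disjunction concatenates.
-- Empty teams never arise, and since ψ'_T only depends on the set T, repeated valuations and
-- set-equal teams can then be discarded.
module Submission where

open import Defs
open import Data.Nat as ℕ using (ℕ)
open import Data.Bool using (Bool; true; false)
import Data.Bool as Bool
open import Data.Fin using (Fin)
import Data.Fin as Fin
open import Data.Vec using (toList; lookup) renaming ([] to []ᵥ; _∷_ to _∷ᵥ_)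
import Data.Vec as Vec
open import Data.Vec.Properties using (lookup∘tabulate) renaming (≡-dec to ≡-decᵥ)
open import Data.List
  using (List; []; _∷_; [_]; _++_; map; zip; allFin; tabulate; filter; deduplicate; cartesianProductWith)
open import Data.List.Properties using (++-assoc; ++-identityʳ; map-++; map-tabulate)
open import Data.List.Membership.Propositional using (_∈_; _∉_; find; lose)
open import Data.List.Membership.Propositional.Properties
  using ( ∈-map⁺; ∈-map⁻; ∈-++⁺ˡ; ∈-++⁺ʳ; ∈-++⁻; ∈-∃++; ∈-tabulate⁺; ∈-tabulate⁻; ∈-allFin
        ; ∈-filter⁺; ∈-filter⁻; ∈-cartesianProductWith⁺; ∈-cartesianProductWith⁻
        ; ∈-deduplicate⁺; ∈-deduplicate⁻ )
open import Data.List.Relation.Binary.Subset.Propositional using (_⊆_)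
open import Data.List.Relation.Binary.Subset.Propositional.Properties
  using (⊆-refl; ∷⁺ʳ; ∈-∷⁺ʳ; map⁺; xs⊆xs++ys; xs⊆ys++xs)
import Data.List.Relation.Binary.Subset.DecPropositional as DecSubset
open import Data.List.Relation.Unary.Any as Any using (here; there)
import Data.List.Relation.Unary.Any.Properties as Any
open import Data.List.Relation.Unary.All as All using (All; []; _∷_)
import Data.List.Relation.Unary.All.Properties as All
open import Data.List.Relation.Unary.AllPairs using ([]; _∷_)
open import Data.List.Relation.Unary.Unique.Propositional using (Unique)
import Data.List.Relation.Unary.Unique.Propositional.Properties as Unique
import Data.List.Relation.Unary.Unique.DecPropositional.Properties as UniqueDec
import Data.List.Relation.Unary.Unique.DecSetoid.Properties as UniqueDecSetoid
open import Data.Product using (Σ; _×_; _,_; proj₁; proj₂; ∃-syntax)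
import Data.Product.Properties as Product
open import Data.Empty using (⊥-elim)
open import Data.Sum using (_⊎_; inj₁; inj₂; [_,_]′)
open import Function using (_∘_)
open import Function.Bundles using (mk⇔; Equivalence)
open import Function.Properties.Equivalence using (⇔-isEquivalence)
open import Relation.Binary.Bundles using (DecSetoid)
open import Relation.Binary.Definitions using (DecidableEquality; Decidable)
open import Relation.Binary.Structures using (IsEquivalence)
open import Relation.Binary.PropositionalEquality
  using (_≡_; _≢_; refl; sym; trans; cong; subst; setoid)
open import Relation.Nullary using (Dec; yes; no)
open import Relation.Nullary.Decidable using (map′; _×-dec_)

private
  variable
    n : ℕ
    Γ Δ : List (Formula n)
    φ φ₁ φ₂ ψ ψ₁ ψ₂ χ : Formula n
    a b L : Atom n
    S T : Team n
    C D : List (Team n)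

weaken : Γ ⊆ Δ → Γ ⊢ φ → Δ ⊢ φ
weaken s (assum m) = assum (s m)
weaken s (⊥E w d) = ⊥E w (weaken s d)
weaken s ⊤I = ⊤I
weaken s (∧I d e) = ∧I (weaken s d) (weaken s e)
weaken s (∧E₁ d) = ∧E₁ (weaken s d)
weaken s (∧E₂ d) = ∧E₂ (weaken s d)
weaken s (⊔I₁ w d) = ⊔I₁ w (weaken s d)
weaken s (⊔I₂ w d) = ⊔I₂ w (weaken s d)
weaken s (⊔E d e f) = ⊔E (weaken s d) (weaken (∷⁺ʳ _ s) e) (weaken (∷⁺ʳ _ s) f)
weaken s (⊆Proj xs y d) = ⊆Proj xs y (weaken s d)
weaken s (⊆Perm xs ys zs d) = ⊆Perm xs ys zs (weaken s d)
weaken s (⊆Ext xs q q∉ d e f) = ⊆Ext xs q q∉ (weaken s d) (weaken (∷⁺ʳ _ s) e) (weaken (∷⁺ʳ _ s) f)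

-- The system has no cut rule; ⊔E applied to φ ⊔ φ plays its role.
cut : WF φ → Γ ⊢ φ → (φ ∷ Γ) ⊢ χ → Γ ⊢ χ
cut w d k = ⊔E (⊔I₁ w d) k k

incl-cast : a ≡ b → Γ ⊢ incl a → Γ ⊢ incl b
incl-cast refl d = d

-- Admissible single-premise rules: unlike _⊢₁_ they compose without cut.
infix 3 _⟹_ _⟺_

_⟹_ : Formula n → Formula n → Set
φ ⟹ ψ = ∀ {Γ} → Γ ⊢ φ → Γ ⊢ ψ

_⟺_ : Formula n → Formula n → Set
φ ⟺ ψ = (φ ⟹ ψ) × (ψ ⟹ φ)

⟹⇒⊢₁ : φ ⟹ ψ → φ ⊢₁ ψ
⟹⇒⊢₁ f = f (assum (here refl))

⟺-trans : φ ⟺ ψ → ψ ⟺ χ → φ ⟺ χ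
⟺-trans (f , g) (f′ , g′) = (λ d → f′ (f d)) , (λ d → g (g′ d))

∧-cong : φ₁ ⟺ φ₂ → ψ₁ ⟺ ψ₂ → φ₁ ∧ ψ₁ ⟺ φ₂ ∧ ψ₂
∧-cong (f , g) (f′ , g′) =
  (λ d → ∧I (f (∧E₁ d)) (f′ (∧E₂ d))) , (λ d → ∧I (g (∧E₁ d)) (g′ (∧E₂ d)))

⊔-mono : WF φ₂ → WF ψ₂ → φ₁ ⟹ φ₂ → ψ₁ ⟹ ψ₂ → φ₁ ⊔ ψ₁ ⟹ φ₂ ⊔ ψ₂
⊔-mono wφ wψ f g d = ⊔E d (⊔I₁ wψ (f (assum (here refl)))) (⊔I₂ wφ (g (assum (here refl))))

⊔-cong : WF φ₁ → WF ψ₁ → WF φ₂ → WF ψ₂ → φ₁ ⟺ φ₂ → ψ₁ ⟺ ψ₂ → φ₁ ⊔ ψ₁ ⟺ φ₂ ⊔ ψ₂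
⊔-cong wφ₁ wψ₁ wφ₂ wψ₂ (f , g) (f′ , g′) = ⊔-mono wφ₂ wψ₂ f f′ , ⊔-mono wφ₁ wψ₁ g g′

graph : Valuation n → Atom n
graph {n} v = zip (toList v) (allFin n)

zip-toList-tabulate : ∀ {m} {A : Set} (v : Valuation m) (f : Fin m → A) →
                      zip (toList v) (tabulate f) ≡ tabulate (λ i → lookup v i , f i)
zip-toList-tabulate []ᵥ       f = refl
zip-toList-tabulate (t ∷ᵥ v) f = cong ((t , f Fin.zero) ∷_) (zip-toList-tabulate v (f ∘ Fin.suc))

graph-tabulate : (v : Valuation n) → graph v ≡ tabulate (λ i → lookup v i , i)
graph-tabulate v = zip-toList-tabulate v (λ i → i)

∈-graph⁺ : (v : Valuation n) (i : Fin n) → (lookup v i , i) ∈ graph v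
∈-graph⁺ v i = subst ((lookup v i , i) ∈_) (sym (graph-tabulate v)) (∈-tabulate⁺ i)

∈-graph⁻ : (v : Valuation n) → ∀ {y} → y ∈ graph v → ∃[ i ] y ≡ (lookup v i , i)
∈-graph⁻ v m = ∈-tabulate⁻ (subst (_ ∈_) (graph-tabulate v) m)

syms-graph : (v : Valuation n) → syms (graph v) ≡ allFin n
syms-graph v = trans (cong syms (graph-tabulate v)) (map-tabulate _ proj₂)

wf-graph : (v : Valuation n) → WF (xv⊆p v)
wf-graph {n} v = subst Unique (sym (syms-graph v)) (Unique.allFin⁺ n)

wf-ψ' : (T : Team n) → WF (ψ' T)
wf-ψ' []          = []
wf-ψ' (v ∷ [])    = wf-graph v
wf-ψ' (v ∷ w ∷ T) = wf-graph v , wf-ψ' (w ∷ T)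

-- Unlike Ψ', this sends [ [] ] to ψ' [] = ⟨⟩ ⊆ ⟨⟩; the two agree on lists of nonempty teams.
⋁ψ' : List (Team n) → Formula n
⋁ψ' []      = ⊥'
⋁ψ' (T ∷ C) = ⨆ψ' T C

wf-⋁ψ' : (C : List (Team n)) → WF (⋁ψ' C)
wf-⋁ψ' []          = _
wf-⋁ψ' (T ∷ [])    = wf-ψ' T
wf-⋁ψ' (T ∷ S ∷ C) = wf-ψ' T , wf-⋁ψ' (S ∷ C)

ψ'-intro : (∀ {v} → v ∈ T → Γ ⊢ xv⊆p v) → Γ ⊢ ψ' T
ψ'-intro {T = []}          h = ⊤I
ψ'-intro {T = v ∷ []}      h = h (here refl)
ψ'-intro {T = v ∷ w ∷ T}   h = ∧I (h (here refl)) (ψ'-intro (h ∘ there))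

ψ'-elim : ∀ {v} → Γ ⊢ ψ' T → v ∈ T → Γ ⊢ xv⊆p v
ψ'-elim {T = v ∷ []}    d (here refl) = d
ψ'-elim {T = v ∷ w ∷ T} d (here refl) = ∧E₁ d
ψ'-elim {T = v ∷ w ∷ T} d (there m)   = ψ'-elim (∧E₂ d) m

ψ'-antimono : T ⊆ S → Γ ⊢ ψ' S → Γ ⊢ ψ' T
ψ'-antimono T⊆S d = ψ'-intro (ψ'-elim d ∘ T⊆S)

ψ'-++ : Γ ⊢ ψ' S → Γ ⊢ ψ' T → Γ ⊢ ψ' (S ++ T)
ψ'-++ {S = S} dS dT = ψ'-intro (λ m → [ ψ'-elim dS , ψ'-elim dT ]′ (∈-++⁻ S m))

⋁ψ'-intro : T ∈ C → Γ ⊢ ψ' T → Γ ⊢ ⋁ψ' C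
⋁ψ'-intro {C = T ∷ []}    (here refl) d = d
⋁ψ'-intro {C = T ∷ S ∷ C} (here refl) d = ⊔I₁ (wf-⋁ψ' (S ∷ C)) d
⋁ψ'-intro {C = T ∷ S ∷ C} (there m)   d = ⊔I₂ (wf-ψ' T) (⋁ψ'-intro m d)

⋁ψ'-elim : (C : List (Team n)) → WF χ → (∀ {T} → T ∈ C → (ψ' T ∷ Γ) ⊢ χ) → Γ ⊢ ⋁ψ' C → Γ ⊢ χ
⋁ψ'-elim []          w k d = ⊥E w d
⋁ψ'-elim (T ∷ [])    w k d = cut (wf-ψ' T) d (k (here refl))
⋁ψ'-elim (T ∷ S ∷ C) w k d =
  ⊔E d (k (here refl)) (⋁ψ'-elim (S ∷ C) w (weaken (∷⁺ʳ _ there) ∘ k ∘ there) (assum (here refl)))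

infix 4 _≼_

_≼_ : List (Team n) → List (Team n) → Set
C ≼ D = ∀ {S} → S ∈ C → ∃[ T ] T ∈ D × T ⊆ S

⊆⇒≼ : C ⊆ D → C ≼ D
⊆⇒≼ C⊆D S∈C = _ , C⊆D S∈C , ⊆-refl

⋁ψ'-mono : C ≼ D → ⋁ψ' C ⟹ ⋁ψ' D
⋁ψ'-mono {C = C} {D = D} C≼D = ⋁ψ'-elim C (wf-⋁ψ' D) λ S∈C →
  let T , T∈D , T⊆S = C≼D S∈C in ⋁ψ'-intro T∈D (ψ'-antimono T⊆S (assum (here refl)))

⋁ψ'-++ : (C D : List (Team n)) → ⋁ψ' C ⊔ ⋁ψ' D ⟺ ⋁ψ' (C ++ D)
⋁ψ'-++ C D = to , from
  where
    to : ⋁ψ' C ⊔ ⋁ψ' D ⟹ ⋁ψ' (C ++ D)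
    to d = ⊔E d (⋁ψ'-mono (⊆⇒≼ (xs⊆xs++ys C D)) (assum (here refl)))
                (⋁ψ'-mono (⊆⇒≼ (xs⊆ys++xs D C)) (assum (here refl)))
    from : ⋁ψ' (C ++ D) ⟹ ⋁ψ' C ⊔ ⋁ψ' D
    from = ⋁ψ'-elim (C ++ D) (wf-⋁ψ' C , wf-⋁ψ' D) λ m →
      [ (λ m₁ → ⊔I₁ (wf-⋁ψ' D) (⋁ψ'-intro m₁ (assum (here refl))))
      , (λ m₂ → ⊔I₂ (wf-⋁ψ' C) (⋁ψ'-intro m₂ (assum (here refl)))) ]′ (∈-++⁻ C m)

⋁ψ'-× : (C D : List (Team n)) → ⋁ψ' C ∧ ⋁ψ' D ⟺ ⋁ψ' (cartesianProductWith _++_ C D)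
⋁ψ'-× C D = to , from
  where
    C×D = cartesianProductWith _++_ C D
    to : ⋁ψ' C ∧ ⋁ψ' D ⟹ ⋁ψ' C×D
    to d = ⋁ψ'-elim C (wf-⋁ψ' C×D)
      (λ S∈C → ⋁ψ'-elim D (wf-⋁ψ' C×D)
        (λ T∈D → ⋁ψ'-intro (∈-cartesianProductWith⁺ _++_ S∈C T∈D)
                           (ψ'-++ (assum (there (here refl))) (assum (here refl))))
        (weaken there (∧E₂ d)))
      (∧E₁ d)
    from-team : ∀ {U} → U ∈ C×D → (ψ' U ∷ Γ) ⊢ ⋁ψ' C ∧ ⋁ψ' D
    from-team U∈C×D with S , T , S∈C , T∈D , refl ← ∈-cartesianProductWith⁻ _++_ C D U∈C×D =
      ∧I (⋁ψ'-intro S∈C (ψ'-antimono ∈-++⁺ˡ (assum (here refl))))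
         (⋁ψ'-intro T∈D (ψ'-antimono (∈-++⁺ʳ S) (assum (here refl))))
    from : ⋁ψ' C×D ⟹ ⋁ψ' C ∧ ⋁ψ' D
    from = ⋁ψ'-elim C×D (wf-⋁ψ' C , wf-⋁ψ' D) from-team

drop-suffix : ∀ (pre L : Atom n) → Γ ⊢ incl (pre ++ L) → Γ ⊢ incl pre
drop-suffix pre []      d = incl-cast (++-identityʳ pre) d
drop-suffix pre (x ∷ L) d = drop-suffix pre L
  (⊆Proj (pre ++ L) x (incl-cast (sym (++-assoc pre L [ x ])) (⊆Perm pre [ x ] L d)))

-- Each column of a is brought, by one block swap, right behind the already selected prefix;
-- the columns of L left over at the end are projected away.
select : ∀ (pre L a : Atom n) → a ⊆ L → Unique (syms a) →
         Γ ⊢ incl (pre ++ L) → Γ ⊢ incl (pre ++ a)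
select pre L []      _   _          d = incl-cast (sym (++-identityʳ pre)) (drop-suffix pre L d)
select pre L (x ∷ a) a⊆L (x∉a ∷ ua) d with L₁ , L₂ , refl ← ∈-∃++ (a⊆L (here refl)) =
  incl-cast (++-assoc pre [ x ] a)
    (select (pre ++ [ x ]) (L₂ ++ L₁) a a⊆L₂L₁ ua
      (incl-cast (sym (++-assoc pre [ x ] (L₂ ++ L₁))) (⊆Perm pre L₁ (x ∷ L₂) d)))
  where
    a⊆L₂L₁ : a ⊆ L₂ ++ L₁
    a⊆L₂L₁ y∈a with ∈-++⁻ L₁ (a⊆L (there y∈a))
    ... | inj₁ y∈L₁         = ∈-++⁺ʳ L₂ y∈L₁
    ... | inj₂ (here refl)  = ⊥-elim (All.lookup x∉a (∈-map⁺ proj₂ y∈a) refl)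
    ... | inj₂ (there y∈L₂) = ∈-++⁺ˡ y∈L₂

restrict : a ⊆ L → Unique (syms a) → incl L ⟹ incl a
restrict {a = a} {L = L} a⊆L ua = select [] L a a⊆L ua

unique-snoc : ∀ {m t} → m ∉ syms b → Unique (syms b) → Unique (syms (b ++ [ t , m ]))
unique-snoc {b = b} m∉b ub =
  subst Unique (sym (map-++ proj₂ b _)) (Unique.++⁺ ub ([] ∷ []) λ { (m∈b , here refl) → m∉b m∈b })

-- ⊆Ext splits on the value of each symbol of M that b does not mention yet.
complete-symbols : (M : List (Fin n)) → Unique (syms b) →
           (∀ {L} → Unique (syms L) → b ⊆ L → M ⊆ syms L → incl L ⟹ χ) →
           incl b ⟹ χ
complete-symbols []      ub k = k ub ⊆-refl (λ ())
complete-symbols {b = b} {χ = χ} (m ∷ M) ub k {Γ} d with Any.any? (m Fin.≟_) (syms b)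
... | yes m∈b = complete-symbols M ub (λ uL b⊆L M⊆L → k uL b⊆L (∈-∷⁺ʳ (map⁺ proj₂ b⊆L m∈b) M⊆L)) d
... | no  m∉b = ⊆Ext b m m∉b d (extend true) (extend false)
  where
    extend : (t : Bool) → (incl (b ++ [ t , m ]) ∷ Γ) ⊢ χ
    extend t = complete-symbols M (unique-snoc m∉b ub)
      (λ uL bt⊆L M⊆L → k uL (bt⊆L ∘ ∈-++⁺ˡ) (∈-∷⁺ʳ (∈-map⁺ proj₂ (bt⊆L (∈-++⁺ʳ b (here refl)))) M⊆L))
      (assum (here refl))

value-at : ∀ (L : Atom n) {i} → i ∈ syms L → ∃[ t ] (t , i) ∈ L
value-at L i∈L with (t , _) , ti∈L , refl ← ∈-map⁻ proj₂ i∈L = t , ti∈L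

value-unique : ∀ {i t u} → Unique (syms L) → (t , i) ∈ L → (u , i) ∈ L → t ≡ u
value-unique _          (here refl) (here refl) = refl
value-unique (i∉L ∷ _)  (here refl) (there ui∈L) = ⊥-elim (All.lookup i∉L (∈-map⁺ proj₂ ui∈L) refl)
value-unique (i∉L ∷ _)  (there ti∈L) (here refl) = ⊥-elim (All.lookup i∉L (∈-map⁺ proj₂ ti∈L) refl)
value-unique (_ ∷ uL)   (there ti∈L) (there ui∈L) = value-unique uL ti∈L ui∈L

complete-atom-graph : Unique (syms L) → (∀ i → i ∈ syms L) →
                      ∃[ v ] graph v ⊆ L × L ⊆ graph v
complete-atom-graph {L = L} uL cover = v , graph⊆L , L⊆graph
  where
    v : Valuation _
    v = Vec.tabulate (λ i → proj₁ (value-at L (cover i)))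
    v-∈ : ∀ i → (lookup v i , i) ∈ L
    v-∈ i = subst (λ t → (t , i) ∈ L) (sym (lookup∘tabulate _ i)) (proj₂ (value-at L (cover i)))
    graph⊆L : graph v ⊆ L
    graph⊆L y∈graph with i , refl ← ∈-graph⁻ v y∈graph = v-∈ i
    L⊆graph : L ⊆ graph v
    L⊆graph {t , i} ti∈L =
      subst (λ u → (u , i) ∈ graph v) (value-unique uL (v-∈ i) ti∈L) (∈-graph⁺ v i)

atom-elim : Unique (syms a) → (∀ v → a ⊆ graph v → xv⊆p v ⟹ χ) → incl a ⟹ χ
atom-elim ua k = complete-symbols (allFin _) ua λ uL a⊆L allFin⊆L →
  let v , graph⊆L , L⊆graph = complete-atom-graph uL (allFin⊆L ∘ ∈-allFin)
  in  k v (L⊆graph ∘ a⊆L) ∘ restrict graph⊆L (wf-graph v)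

allValuations : ∀ n → List (Valuation n)
allValuations ℕ.zero    = [ []ᵥ ]
allValuations (ℕ.suc n) = cartesianProductWith _∷ᵥ_ (true ∷ false ∷ []) (allValuations n)

∈-allValuations : (v : Valuation n) → v ∈ allValuations n
∈-allValuations []ᵥ       = here refl
∈-allValuations (t ∷ᵥ v) = ∈-cartesianProductWith⁺ _∷ᵥ_ (∈-bools t) (∈-allValuations v)
  where
    ∈-bools : ∀ t → t ∈ true ∷ false ∷ []
    ∈-bools true  = here refl
    ∈-bools false = there (here refl)

module _ {n : ℕ} (a : Atom n) where
  open DecSubset (Product.≡-dec Bool._≟_ (Fin._≟_ {n})) using (_⊆?_)

  extends? : (v : Valuation n) → Dec (a ⊆ graph v)
  extends? v = a ⊆? graph v

  atomTeams : List (Team n)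
  atomTeams = map [_] (filter extends? (allValuations n))

  atom-normal : Unique (syms a) → incl a ⟺ ⋁ψ' atomTeams
  atom-normal ua = to , ⋁ψ'-elim atomTeams ua from-team
    where
      to : incl a ⟹ ⋁ψ' atomTeams
      to = atom-elim ua λ v a⊆v →
        ⋁ψ'-intro (∈-map⁺ [_] (∈-filter⁺ extends? (∈-allValuations v) a⊆v))
      from-team : ∀ {T} → T ∈ atomTeams → (ψ' T ∷ Γ) ⊢ incl a
      from-team T∈ with v , v∈ , refl ← ∈-map⁻ [_] T∈ =
        restrict (proj₂ (∈-filter⁻ extends? {xs = allValuations n} v∈)) ua (assum (here refl))

NonEmptyTeams : List (Team n) → Set
NonEmptyTeams = All (_≢ [])

++-nonEmpty : S ≢ [] → S ++ T ≢ []
++-nonEmpty {S = []}    S≢[] = ⊥-elim (S≢[] refl)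
++-nonEmpty {S = _ ∷ _} _    = λ ()

normalForm : (φ : Formula n) → WF φ → ∃[ C ] NonEmptyTeams C × (φ ⟺ ⋁ψ' C)
normalForm ⊥'       _  = [] , [] , (λ d → d) , (λ d → d)
normalForm (incl a) ua = atomTeams a , All.map⁺ (All.universal (λ _ ()) _) , atom-normal a ua
normalForm (φ ∧ ψ) (wφ , wψ)
  with C , neC , φ⟺C ← normalForm φ wφ | D , neD , ψ⟺D ← normalForm ψ wψ =
  cartesianProductWith _++_ C D ,
  All.cartesianProductWith⁺ (setoid _) (setoid _) _++_ C D (λ S∈C _ → ++-nonEmpty (All.lookup neC S∈C)) ,
  ⟺-trans (∧-cong φ⟺C ψ⟺D) (⋁ψ'-× C D)
normalForm (φ ⊔ ψ) (wφ , wψ)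
  with C , neC , φ⟺C ← normalForm φ wφ | D , neD , ψ⟺D ← normalForm ψ wψ =
  C ++ D , All.++⁺ neC neD , ⟺-trans (⊔-cong wφ wψ (wf-⋁ψ' C) (wf-⋁ψ' D) φ⟺C ψ⟺D) (⋁ψ'-++ C D)

module _ {n : ℕ} where
  _≟ᵥ_ : DecidableEquality (Valuation n)
  _≟ᵥ_ = ≡-decᵥ Bool._≟_

  open DecSubset _≟ᵥ_ using (_⊆?_)

  ≋-isEquivalence : IsEquivalence (_≋_ {n})
  ≋-isEquivalence = record
    { refl  = λ _ → ⇔.refl
    ; sym   = λ S≋T v → ⇔.sym (S≋T v)
    ; trans = λ S≋T T≋U v → ⇔.trans (S≋T v) (T≋U v)
    }
    where module ⇔ = IsEquivalence ⇔-isEquivalence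

  open IsEquivalence ≋-isEquivalence using () renaming (refl to ≋-refl; trans to ≋-trans)

  _≋?_ : Decidable (_≋_ {n})
  S ≋? T = map′ to from (S ⊆? T ×-dec T ⊆? S)
    where
      to : S ⊆ T × T ⊆ S → S ≋ T
      to (S⊆T , T⊆S) _ = mk⇔ S⊆T T⊆S
      from : S ≋ T → S ⊆ T × T ⊆ S
      from S≋T = Equivalence.to (S≋T _) , Equivalence.from (S≋T _)

  ≋-decSetoid : DecSetoid _ _
  ≋-decSetoid = record
    { Carrier          = Team n
    ; _≈_              = _≋_
    ; isDecEquivalence = record { isEquivalence = ≋-isEquivalence ; _≟_ = _≋?_ }
    }

  asSetOfTeams : List (Team n) → List (Team n)
  asSetOfTeams C = deduplicate _≋?_ (map (deduplicate _≟ᵥ_) C)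

  asSetOfTeams-isSetOfTeams : (C : List (Team n)) → IsSetOfTeams (asSetOfTeams C)
  asSetOfTeams-isSetOfTeams C =
    All.deduplicate⁺ _≋?_ (All.map⁺ (All.universal (UniqueDec.deduplicate-! _≟ᵥ_) C)) ,
    UniqueDecSetoid.deduplicate-! ≋-decSetoid _

  asSetOfTeams-nonEmpty : NonEmptyTeams C → NonEmptyTeams (asSetOfTeams C)
  asSetOfTeams-nonEmpty neC = All.deduplicate⁺ _≋?_ (All.map⁺ (All.map deduplicate-nonEmpty neC))
    where
      deduplicate-nonEmpty : S ≢ [] → deduplicate _≟ᵥ_ S ≢ []
      deduplicate-nonEmpty {S = []}    S≢[] = S≢[]
      deduplicate-nonEmpty {S = _ ∷ _} _    = λ ()

  asSetOfTeams-⟺ : (C : List (Team n)) → ⋁ψ' C ⟺ ⋁ψ' (asSetOfTeams C)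
  asSetOfTeams-⟺ C = ⋁ψ'-mono C≼asSetOfTeams , ⋁ψ'-mono asSetOfTeams≼C
    where
      C≼asSetOfTeams : C ≼ asSetOfTeams C
      C≼asSetOfTeams {S} S∈C =
        let S′ = deduplicate _≟ᵥ_ S
            T , T∈ , T≋S′ = find (Any.deduplicate⁺ _≋?_ ≋-trans
                                    (lose {P = _≋ S′} (∈-map⁺ (deduplicate _≟ᵥ_) S∈C) ≋-refl))
        in  T , T∈ , ∈-deduplicate⁻ _≟ᵥ_ S ∘ Equivalence.to (T≋S′ _)
      asSetOfTeams≼C : asSetOfTeams C ≼ C
      asSetOfTeams≼C T∈ with S , S∈C , refl ← ∈-map⁻ (deduplicate _≟ᵥ_) (∈-deduplicate⁻ _≋?_ _ T∈) =
        S , S∈C , ∈-deduplicate⁺ _≟ᵥ_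

Ψ'≡⋁ψ' : NonEmptyTeams C → Ψ' C ≡ ⋁ψ' C
Ψ'≡⋁ψ' []                        = refl
Ψ'≡⋁ψ' {C = [] ∷ _}      (ne ∷ _) = ⊥-elim (ne refl)
Ψ'≡⋁ψ' {C = (_ ∷ _) ∷ _} _        = refl

mainTheorem6 : (n : ℕ) (φ : Formula n) → WF φ →
    Σ (List (Team n)) λ C →
      IsSetOfTeams C × C ≢ [] × (C ≡ [ [] ] ⊎ [] ∉ C) ×
      (φ ⊢₁ Ψ' C) × (Ψ' C ⊢₁ φ)
mainTheorem6 n φ wφ with normalForm φ wφ
... | [] , _ , φ⟺⊥ =
  [ [] ] , ([] ∷ [] , [] ∷ []) , (λ ()) , inj₁ refl , ⟹⇒⊢₁ (proj₁ φ⟺⊥) , ⟹⇒⊢₁ (proj₂ φ⟺⊥)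
... | C@(_ ∷ _) , neC , φ⟺C =
  asSetOfTeams C , asSetOfTeams-isSetOfTeams C , (λ ()) , inj₂ (λ []∈ → All.lookup neC′ []∈ refl) ,
  ⟹⇒⊢₁ (proj₁ φ⟺Ψ') , ⟹⇒⊢₁ (proj₂ φ⟺Ψ')
  where
    neC′ : NonEmptyTeams (asSetOfTeams C)
    neC′ = asSetOfTeams-nonEmpty neC
    φ⟺Ψ' : φ ⟺ Ψ' (asSetOfTeams C)
    φ⟺Ψ' rewrite Ψ'≡⋁ψ' neC′ = ⟺-trans φ⟺C (asSetOfTeams-⟺ C)
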